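{- Let $S=\mathcal{P}_S\cup\mathcal{L}_S$ be a resolving set for a biaffine plane $B_q$ of order $q$, where $\mathcal{P}_S$ is a set of points and $\mathcal{L}_S$ a set of lines. Then $|\mathcal{P}_S|\geq q-|S|/(q-1)$ and $|\mathcal{L}_S|\geq q-|S|/(q-1)$.
   Context: A biaffine plane of order $q$ is obtained from an affine plane of order $q$ by deleting all lines of one parallel class (keeping all points). A resolving set is a vertex set $S$ of its incidence graph (bipartite graph on points and lines, adjacency = incidence) such that every two distinct vertices $u\neq v$ have some $x\in S$ with $d(u,x)\neq d(v,x)$. -}

module Defs where

open import Data.Nat using (ℕ; zero; suc; _+_; _*_; _∸_; _≤_; _<_)
open import Data.Bool using (Bool; T)
open import Data.Unit using (⊤)
open import Data.Fin using (Fin)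
open import Data.Fin.Subset using (Subset; _∈_; ∣_∣)
open import Data.Vec using (tabulate)
open import Data.Product using (Σ; ∃; _×_; _,_)
open import Data.Sum using (_⊎_; inj₁; inj₂)
open import Relation.Nullary using (¬_)
open import Relation.Binary.PropositionalEquality using (_≡_; _≢_)

record AffinePlane (q : ℕ) : Set where
  field
    nP nL : ℕ
    inc   : Fin nP → Fin nL → Bool

  Point : Set
  Point = Fin nP

  Line : Set
  Line = Fin nL

  Inc : Point → Line → Set
  Inc p ℓ = T (inc p ℓ)

  Parallel : Line → Line → Set
  Parallel ℓ m = ℓ ≡ m ⊎ (∀ p → ¬ (Inc p ℓ × Inc p m))

  Collinear : Point → Point → Point → Set
  Collinear a b c = ∃ λ ℓ → Inc a ℓ × Inc b ℓ × Inc c ℓ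

  pointsOn : Line → Subset nP
  pointsOn ℓ = tabulate (λ p → inc p ℓ)

  field
    join        : ∀ p p' → p ≢ p' → ∃ λ ℓ → Inc p ℓ × Inc p' ℓ
    join-unique : ∀ p p' → p ≢ p' → ∀ ℓ m →
                  Inc p ℓ → Inc p' ℓ → Inc p m → Inc p' m → ℓ ≡ m
    playfair        : ∀ p ℓ → ¬ Inc p ℓ → ∃ λ m → Inc p m × Parallel m ℓ
    playfair-unique : ∀ p ℓ → ¬ Inc p ℓ → ∀ m m' →
                      Inc p m → Parallel m ℓ → Inc p m' → Parallel m' ℓ → m ≡ m'
    nondegenerate : ∃ λ a → ∃ λ b → ∃ λ c → ¬ Collinear a b c
    order : ∀ ℓ → ∣ pointsOn ℓ ∣ ≡ q

module Biaffine {q : ℕ} (A : AffinePlane q) (ℓ₀ : AffinePlane.Line A) where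
  open AffinePlane A

  -- lines of the biaffine plane: those not in the parallel class of ℓ₀
  Kept : Line → Set
  Kept ℓ = ¬ Parallel ℓ ℓ₀

  Vtx : Set
  Vtx = Point ⊎ Line

  IsVertex : Vtx → Set
  IsVertex (inj₁ p) = ⊤
  IsVertex (inj₂ ℓ) = Kept ℓ

  Adj : Vtx → Vtx → Set
  Adj (inj₁ p) (inj₁ p') = Fin 0
  Adj (inj₁ p) (inj₂ ℓ)  = Inc p ℓ × Kept ℓ
  Adj (inj₂ ℓ) (inj₁ p)  = Inc p ℓ × Kept ℓ
  Adj (inj₂ ℓ) (inj₂ m)  = Fin 0

  data Walk : Vtx → Vtx → ℕ → Set where
    here : ∀ {u} → Walk u u zero
    step : ∀ {u w v n} → Adj u w → Walk w v n → Walk u v (suc n)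

  Dist : Vtx → Vtx → ℕ → Set
  Dist u v n = Walk u v n × (∀ m → m < n → ¬ Walk u v m)

  InS : Subset nP → Subset nL → Vtx → Set
  InS PS LS (inj₁ p) = p ∈ PS
  InS PS LS (inj₂ ℓ) = ℓ ∈ LS

  Resolving : Subset nP → Subset nL → Set
  Resolving PS LS =
    ∀ u v → IsVertex u → IsVertex v → u ≢ v →
      ∃ λ x → InS PS LS x × ∃ λ n → ∃ λ m → Dist u x n × Dist v x m × n ≢ m

module Submission where

-- Call a vertex lonely if it is neither in S nor adjacent to a vertex of S. Two distinct lonely
-- kept lines in one parallel class have the same distance to every vertex of S, since any walk
-- leaving one of them can be rerouted to leave from the other with the same length; likewise for
-- two distinct lonely points on one vertical line (a line parallel to the deleted class). So each
-- of the q parallel classes of kept lines and each of the q vertical lines holds at most one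
-- lonely element. A kept line adjacent to S is determined by a point of P_S on it together with
-- its class, and a point adjacent to S by a line of L_S through it together with its vertical
-- line. Hence q² ≤ #kept lines ≤ |L_S| + q|P_S| + q and q² ≤ #points ≤ |P_S| + q|L_S| + q,
-- which rearrange to the two inequalities.

open import Defs
open import Level using (Level)
open import Data.Nat using (ℕ; zero; suc; _+_; _*_; _∸_; _≤_; _<_; z≤n; s≤s)
open import Data.Nat.Properties
  using (module ≤-Reasoning; ≤-trans; ≤-reflexive; +-suc; +-monoʳ-≤; +-mono-≤; n≤1+n; <-cmp;
         +-cancelʳ-≤; +-comm)
open import Data.Nat.Tactic.RingSolver using (solve-∀)
open import Data.Empty using (⊥; ⊥-elim)
open import Data.Fin using (Fin; zero; suc; _≟_; fromℕ<; combine; remQuot)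
open import Data.Fin.Properties
  using (any?; all?; suc-injective; injective⇒≤; combine-injective; combine-remQuot)
open import Data.Fin.Subset using (Subset; inside; outside; _∈_; _∉_; _∪_; _⊆_; ∣_∣; ⊤)
open import Data.Fin.Subset.Properties using (p⊆q⇒∣p∣≤∣q∣; _∈?_; x∈p∪q⁺; ∈⊤)
open import Data.Vec using (_∷_; []; here; there; tabulate)
open import Data.Vec.Properties using ([]=⇒lookup; lookup⇒[]=; lookup∘tabulate)
open import Data.Product using (∃; _×_; _,_; proj₁; proj₂; uncurry)
open import Data.Sum using (inj₁; inj₂)
open import Data.Sum.Properties using (≡-dec; inj₁-injective; inj₂-injective)
open import Function using (Injective; _∘_)
open import Relation.Nullary using (¬_; Dec; does; yes; no; ¬?; _×-dec_; _⊎-dec_)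
open import Relation.Nullary.Decidable using (T?; dec-true)
open import Relation.Unary using (Pred; Decidable)
open import Relation.Binary.Definitions using (tri<; tri≈; tri>)
open import Relation.Binary.PropositionalEquality
  using (_≡_; _≢_; refl; sym; trans; cong; cong₂; subst; subst₂; module ≡-Reasoning)

module SubsetCounting where

  private variable
    ℓ : Level
    n m k : ℕ
    x y : Fin n
    p q r : Subset n

  select : {P : Pred (Fin n) ℓ} → Decidable P → Subset n
  select P? = tabulate (λ x → does (P? x))

  module _ {P : Pred (Fin n) ℓ} (P? : Decidable P) where

    ∈-select⁺ : P x → x ∈ select P?
    ∈-select⁺ {x} px = lookup⇒[]= x _ (trans (lookup∘tabulate _ x) (dec-true (P? x) px))

    ∈-select⁻ : x ∈ select P? → P x
    ∈-select⁻ {x} x∈ with P? x | trans (sym (lookup∘tabulate _ x)) ([]=⇒lookup x∈)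
    ... | yes px | _  = px
    ... | no  _  | ()

  ∣p∪q∣≤∣p∣+∣q∣ : (p q : Subset n) → ∣ p ∪ q ∣ ≤ ∣ p ∣ + ∣ q ∣
  ∣p∪q∣≤∣p∣+∣q∣ [] [] = z≤n
  ∣p∪q∣≤∣p∣+∣q∣ (inside ∷ p) (inside ∷ q) =
    s≤s (≤-trans (∣p∪q∣≤∣p∣+∣q∣ p q) (+-monoʳ-≤ ∣ p ∣ (n≤1+n ∣ q ∣)))
  ∣p∪q∣≤∣p∣+∣q∣ (inside ∷ p) (outside ∷ q) = s≤s (∣p∪q∣≤∣p∣+∣q∣ p q)
  ∣p∪q∣≤∣p∣+∣q∣ (outside ∷ p) (inside ∷ q) =
    ≤-trans (s≤s (∣p∪q∣≤∣p∣+∣q∣ p q)) (≤-reflexive (sym (+-suc ∣ p ∣ ∣ q ∣)))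
  ∣p∪q∣≤∣p∣+∣q∣ (outside ∷ p) (outside ∷ q) = ∣p∪q∣≤∣p∣+∣q∣ p q

  index : x ∈ p → Fin ∣ p ∣
  index {p = inside ∷ _} here = zero
  index {p = inside ∷ _} (there x∈p) = suc (index x∈p)
  index {p = outside ∷ _} (there x∈p) = index x∈p

  index-injective : (x∈p : x ∈ p) (y∈p : y ∈ p) → index x∈p ≡ index y∈p → x ≡ y
  index-injective {p = inside ∷ _} here here _ = refl
  index-injective {p = inside ∷ _} (there x∈p) (there y∈p) e =
    cong suc (index-injective x∈p y∈p (suc-injective e))
  index-injective {p = outside ∷ _} (there x∈p) (there y∈p) e = cong suc (index-injective x∈p y∈p e)

  element : (p : Subset n) → Fin ∣ p ∣ → Fin n
  element (inside ∷ p) zero = zero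
  element (inside ∷ p) (suc i) = suc (element p i)
  element (outside ∷ p) i = suc (element p i)

  element-∈ : (p : Subset n) (i : Fin ∣ p ∣) → element p i ∈ p
  element-∈ (inside ∷ p) zero = here
  element-∈ (inside ∷ p) (suc i) = there (element-∈ p i)
  element-∈ (outside ∷ p) i = there (element-∈ p i)

  element-injective : (p : Subset n) → Injective _≡_ _≡_ (element p)
  element-injective (inside ∷ p) {zero} {zero} e = refl
  element-injective (inside ∷ p) {suc i} {suc j} e = cong suc (element-injective p (suc-injective e))
  element-injective (outside ∷ p) e = element-injective p (suc-injective e)

  remQuot-injective : ∀ {m} n → Injective _≡_ _≡_ (remQuot {m} n)
  remQuot-injective {m} n {i} {j} e = begin
    i                                 ≡⟨ combine-remQuot {m} n i ⟨
    uncurry combine (remQuot {m} n i) ≡⟨ cong (uncurry combine) e ⟩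
    uncurry combine (remQuot {m} n j) ≡⟨ combine-remQuot {m} n j ⟩
    j                                 ∎
    where open ≡-Reasoning

  ∣p∣≤m : (f : ∀ {x} → x ∈ p → Fin m) →
          (∀ {x y} (x∈p : x ∈ p) (y∈p : y ∈ p) → f x∈p ≡ f y∈p → x ≡ y) → ∣ p ∣ ≤ m
  ∣p∣≤m {p = p} f f-inj =
    injective⇒≤ (λ {i} {j} e → element-injective p (f-inj (element-∈ p i) (element-∈ p j) e))

  m≤∣p∣ : (f : Fin m → Fin n) → (∀ i → f i ∈ p) → Injective _≡_ _≡_ f → m ≤ ∣ p ∣
  m≤∣p∣ f f∈p f-inj = injective⇒≤ (λ {i} {j} e → f-inj (index-injective (f∈p i) (f∈p j) e))

  ∣p∣≤∣q∣ : (f : ∀ {x} → x ∈ p → Fin m) → (∀ {x} (x∈p : x ∈ p) → f x∈p ∈ q) →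
            (∀ {x y} (x∈p : x ∈ p) (y∈p : y ∈ p) → f x∈p ≡ f y∈p → x ≡ y) → ∣ p ∣ ≤ ∣ q ∣
  ∣p∣≤∣q∣ f f∈q f-inj = ∣p∣≤m (λ x∈p → index (f∈q x∈p))
    (λ x∈p y∈p e → f-inj x∈p y∈p (index-injective (f∈q x∈p) (f∈q y∈p) e))

  ∣p∣≤∣q∣*∣r∣ : (f : ∀ {x} → x ∈ p → Fin m) → (∀ {x} (x∈p : x ∈ p) → f x∈p ∈ q) →
                (g : ∀ {x} → x ∈ p → Fin k) → (∀ {x} (x∈p : x ∈ p) → g x∈p ∈ r) →
                (∀ {x y} (x∈p : x ∈ p) (y∈p : y ∈ p) → f x∈p ≡ f y∈p → g x∈p ≡ g y∈p → x ≡ y) →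
                ∣ p ∣ ≤ ∣ q ∣ * ∣ r ∣
  ∣p∣≤∣q∣*∣r∣ f f∈q g g∈r fg-inj =
    ∣p∣≤m (λ x∈p → combine (index (f∈q x∈p)) (index (g∈r x∈p))) λ x∈p y∈p e →
      let ef , eg = combine-injective _ _ _ _ e in
      fg-inj x∈p y∈p (index-injective (f∈q x∈p) (f∈q y∈p) ef) (index-injective (g∈r x∈p) (g∈r y∈p) eg)

  ∣q∣*∣r∣≤∣p∣ : (h : ∀ {x y} → x ∈ q → y ∈ r → Fin n) →
                (∀ {x y} (x∈q : x ∈ q) (y∈r : y ∈ r) → h x∈q y∈r ∈ p) →
                (∀ {x y x′ y′} (x∈q : x ∈ q) (y∈r : y ∈ r) (x′∈q : x′ ∈ q) (y′∈r : y′ ∈ r) →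
                   h x∈q y∈r ≡ h x′∈q y′∈r → x ≡ x′ × y ≡ y′) →
                ∣ q ∣ * ∣ r ∣ ≤ ∣ p ∣
  ∣q∣*∣r∣≤∣p∣ {q = q} {r = r} h h∈p h-inj = m≤∣p∣ pair (λ i → h∈p _ _) pair-injective
    where
    pair : Fin (∣ q ∣ * ∣ r ∣) → Fin _
    pair i = let a , b = remQuot ∣ r ∣ i in h (element-∈ q a) (element-∈ r b)
    pair-injective : Injective _≡_ _≡_ pair
    pair-injective {i} {j} e =
      let a , b = remQuot ∣ r ∣ i ; a′ , b′ = remQuot ∣ r ∣ j
          ex , ey = h-inj (element-∈ q a) (element-∈ r b) (element-∈ q a′) (element-∈ r b′) e in
      remQuot-injective {∣ q ∣} ∣ r ∣ (cong₂ _,_ (element-injective q ex) (element-injective r ey))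

  module _ {X S : Subset n} {T : Subset m} {C : Subset k}
           {I : Fin n → Fin m → Set ℓ} (I? : ∀ x y → Dec (I x y))
           (cls : ∀ {x} → x ∈ X → Fin k) (cls∈C : ∀ {x} (x∈X : x ∈ X) → cls x∈X ∈ C)
    where

    Touched : Fin n → Set ℓ
    Touched x = ∃ λ y → y ∈ T × I x y

    private
      touched? : ∀ x → Dec (Touched x)
      touched? x = any? (λ y → (y ∈? T) ×-dec I? x y)

      touched-in-X? : ∀ x → Dec (x ∈ X × Touched x)
      touched-in-X? x = (x ∈? X) ×-dec touched? x

      lonely-in-X? : ∀ x → Dec (x ∈ X × x ∉ S × ¬ Touched x)
      lonely-in-X? x = (x ∈? X) ×-dec ¬? (x ∈? S) ×-dec ¬? (touched? x)

      touched lonely : Subset n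
      touched = select touched-in-X?
      lonely  = select lonely-in-X?

    -- X splits into S, the elements with a neighbour in T (each determined by that neighbour and
    -- its class), and the remaining lonely ones (at most one per class).
    ∣X∣≤∣S∣+∣T∣*∣C∣+∣C∣ :
      (∀ {x x′ y} (x∈X : x ∈ X) (x′∈X : x′ ∈ X) → cls x∈X ≡ cls x′∈X →
         y ∈ T → I x y → I x′ y → x ≡ x′) →
      (∀ {x x′} (x∈X : x ∈ X) (x′∈X : x′ ∈ X) → cls x∈X ≡ cls x′∈X →
         x ∉ S → x′ ∉ S → ¬ Touched x → ¬ Touched x′ → x ≡ x′) →
      ∣ X ∣ ≤ ∣ S ∣ + (∣ T ∣ * ∣ C ∣ + ∣ C ∣)
    ∣X∣≤∣S∣+∣T∣*∣C∣+∣C∣ cls-injective-on-neighbours cls-injective-on-lonely = begin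
      ∣ X ∣                             ≤⟨ p⊆q⇒∣p∣≤∣q∣ X⊆S∪touched∪lonely ⟩
      ∣ S ∪ (touched ∪ lonely) ∣        ≤⟨ ∣p∪q∣≤∣p∣+∣q∣ S _ ⟩
      ∣ S ∣ + ∣ touched ∪ lonely ∣      ≤⟨ +-monoʳ-≤ ∣ S ∣ (∣p∪q∣≤∣p∣+∣q∣ touched lonely) ⟩
      ∣ S ∣ + (∣ touched ∣ + ∣ lonely ∣) ≤⟨ +-monoʳ-≤ ∣ S ∣ (+-mono-≤ ∣touched∣≤∣T∣*∣C∣ ∣lonely∣≤∣C∣) ⟩
      ∣ S ∣ + (∣ T ∣ * ∣ C ∣ + ∣ C ∣)    ∎
      where
      open ≤-Reasoning

      X⊆S∪touched∪lonely : X ⊆ S ∪ (touched ∪ lonely)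
      X⊆S∪touched∪lonely {x} x∈X with x ∈? S | touched? x
      ... | yes x∈S | _  = x∈p∪q⁺ (inj₁ x∈S)
      ... | no  x∉S | yes t = x∈p∪q⁺ (inj₂ (x∈p∪q⁺ (inj₁ (∈-select⁺ touched-in-X? (x∈X , t)))))
      ... | no  x∉S | no ¬t = x∈p∪q⁺ (inj₂ (x∈p∪q⁺ (inj₂ (∈-select⁺ lonely-in-X? (x∈X , x∉S , ¬t)))))

      touched-info : ∀ {x} → x ∈ touched → x ∈ X × Touched x
      touched-info = ∈-select⁻ touched-in-X?

      lonely-info : ∀ {x} → x ∈ lonely → x ∈ X × x ∉ S × ¬ Touched x
      lonely-info = ∈-select⁻ lonely-in-X?

      in-X : ∀ {x} → x ∈ touched → x ∈ X
      in-X x∈ = proj₁ (touched-info x∈)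

      neighbour : ∀ {x} → x ∈ touched → Fin m
      neighbour x∈ = proj₁ (proj₂ (touched-info x∈))

      neighbour-∈T : ∀ {x} (x∈ : x ∈ touched) → neighbour x∈ ∈ T
      neighbour-∈T x∈ = proj₁ (proj₂ (proj₂ (touched-info x∈)))

      neighbour-adjacent : ∀ {x} (x∈ : x ∈ touched) → I x (neighbour x∈)
      neighbour-adjacent x∈ = proj₂ (proj₂ (proj₂ (touched-info x∈)))

      ∣touched∣≤∣T∣*∣C∣ : ∣ touched ∣ ≤ ∣ T ∣ * ∣ C ∣
      ∣touched∣≤∣T∣*∣C∣ =
        ∣p∣≤∣q∣*∣r∣ neighbour neighbour-∈T (λ x∈ → cls (in-X x∈)) (λ x∈ → cls∈C (in-X x∈))
          λ {_} {x′} x∈ x′∈ same-neighbour same-cls →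
            cls-injective-on-neighbours (in-X x∈) (in-X x′∈) same-cls (neighbour-∈T x∈)
              (neighbour-adjacent x∈) (subst (I x′) (sym same-neighbour) (neighbour-adjacent x′∈))

      ∣lonely∣≤∣C∣ : ∣ lonely ∣ ≤ ∣ C ∣
      ∣lonely∣≤∣C∣ =
        ∣p∣≤∣q∣ (λ x∈ → cls (proj₁ (lonely-info x∈))) (λ x∈ → cls∈C (proj₁ (lonely-info x∈)))
        λ x∈ x′∈ same-cls → let x∈X , x∉S , ¬t = lonely-info x∈ ; x′∈X , x′∉S , ¬t′ = lonely-info x′∈ in
          cls-injective-on-lonely x∈X x′∈X same-cls x∉S x′∉S ¬t ¬t′

open SubsetCounting

module AffineGeometry {q : ℕ} (A : AffinePlane q) where
  open AffinePlane A

  Inc? : ∀ p ℓ → Dec (Inc p ℓ)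
  Inc? p ℓ = T? (inc p ℓ)

  -- pointsOn ℓ is definitionally select (λ p → Inc? p ℓ).
  ∈-pointsOn⁺ : ∀ {p ℓ} → Inc p ℓ → p ∈ pointsOn ℓ
  ∈-pointsOn⁺ {ℓ = ℓ} = ∈-select⁺ (λ p → Inc? p ℓ)

  ∈-pointsOn⁻ : ∀ {p ℓ} → p ∈ pointsOn ℓ → Inc p ℓ
  ∈-pointsOn⁻ {ℓ = ℓ} = ∈-select⁻ (λ p → Inc? p ℓ)

  Parallel? : ∀ ℓ m → Dec (Parallel ℓ m)
  Parallel? ℓ m = (ℓ ≟ m) ⊎-dec all? (λ p → ¬? (Inc? p ℓ ×-dec Inc? p m))

  ∦⇒meet : ∀ {ℓ m} → ¬ Parallel ℓ m → ∃ λ p → Inc p ℓ × Inc p m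
  ∦⇒meet {ℓ} {m} ℓ∦m with any? (λ p → Inc? p ℓ ×-dec Inc? p m)
  ... | yes meet = meet
  ... | no ¬meet = ⊥-elim (ℓ∦m (inj₂ (λ p p∈ℓm → ¬meet (p , p∈ℓm))))

  ∥-meet⇒≡ : ∀ {ℓ m p} → Parallel ℓ m → Inc p ℓ → Inc p m → ℓ ≡ m
  ∥-meet⇒≡ (inj₁ ℓ≡m) _ _ = ℓ≡m
  ∥-meet⇒≡ {p = p} (inj₂ disjoint) p∈ℓ p∈m = ⊥-elim (disjoint p (p∈ℓ , p∈m))

  ∥-refl : ∀ {ℓ} → Parallel ℓ ℓ
  ∥-refl = inj₁ refl

  ∥-sym : ∀ {ℓ m} → Parallel ℓ m → Parallel m ℓ
  ∥-sym (inj₁ ℓ≡m) = inj₁ (sym ℓ≡m)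
  ∥-sym (inj₂ disjoint) = inj₂ (λ p (p∈m , p∈ℓ) → disjoint p (p∈ℓ , p∈m))

  -- Two lines through a point p, both parallel to m, coincide: by Playfair if p ∉ m,
  -- and because both then meet m in p otherwise.
  ∥-trans : ∀ {ℓ m n} → Parallel ℓ m → Parallel m n → Parallel ℓ n
  ∥-trans {ℓ} {m} {n} ℓ∥m m∥n with ℓ ≟ n
  ... | yes ℓ≡n = inj₁ ℓ≡n
  ... | no ℓ≢n = inj₂ (λ p (p∈ℓ , p∈n) → ℓ≢n (through p p∈ℓ p∈n))
    where
    through : ∀ p → Inc p ℓ → Inc p n → ℓ ≡ n
    through p p∈ℓ p∈n with Inc? p m
    ... | yes p∈m = trans (∥-meet⇒≡ ℓ∥m p∈ℓ p∈m) (∥-meet⇒≡ m∥n p∈m p∈n)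
    ... | no p∉m = playfair-unique p m p∉m ℓ n p∈ℓ ℓ∥m p∈n (∥-sym m∥n)

  parallelThrough : ∀ p ℓ → ∃ λ m → Inc p m × Parallel m ℓ
  parallelThrough p ℓ with Inc? p ℓ
  ... | yes p∈ℓ = ℓ , p∈ℓ , ∥-refl
  ... | no p∉ℓ = playfair p ℓ p∉ℓ

  ∉∈⇒≢ : ∀ {p p′ ℓ} → ¬ Inc p ℓ → Inc p′ ℓ → p ≢ p′
  ∉∈⇒≢ p∉ℓ p′∈ℓ refl = p∉ℓ p′∈ℓ

  parallel-through-unique : ∀ {ℓ m n p} → Parallel ℓ n → Parallel m n → Inc p ℓ → Inc p m → ℓ ≡ m
  parallel-through-unique ℓ∥n m∥n = ∥-meet⇒≡ (∥-trans ℓ∥n (∥-sym m∥n))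

  common-point-unique : ∀ {ℓ m p p′} → ℓ ≢ m → Inc p ℓ → Inc p m → Inc p′ ℓ → Inc p′ m → p ≡ p′
  common-point-unique {ℓ} {m} {p} {p′} ℓ≢m p∈ℓ p∈m p′∈ℓ p′∈m with p ≟ p′
  ... | yes p≡p′ = p≡p′
  ... | no p≢p′ = ⊥-elim (ℓ≢m (join-unique p p′ p≢p′ ℓ m p∈ℓ p′∈ℓ p∈m p′∈m))

  point-off : ∀ ℓ → ∃ λ p → ¬ Inc p ℓ
  point-off ℓ with nondegenerate
  ... | a , b , c , ¬collinear with Inc? a ℓ | Inc? b ℓ | Inc? c ℓ
  ... | no a∉ℓ | _ | _ = a , a∉ℓ
  ... | yes _ | no b∉ℓ | _ = b , b∉ℓ
  ... | yes _ | yes _ | no c∉ℓ = c , c∉ℓ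
  ... | yes a∈ℓ | yes b∈ℓ | yes c∈ℓ = ⊥-elim (¬collinear (ℓ , a∈ℓ , b∈ℓ , c∈ℓ))

  point-on : 0 < q → ∀ ℓ → ∃ λ p → Inc p ℓ
  point-on 0<q ℓ = element (pointsOn ℓ) i , ∈-pointsOn⁻ (element-∈ (pointsOn ℓ) i)
    where
    i : Fin ∣ pointsOn ℓ ∣
    i = subst Fin (sym (order ℓ)) (fromℕ< 0<q)

module BiaffineGeometry {q : ℕ} (A : AffinePlane q) (ℓ₀ : AffinePlane.Line A) where
  open AffinePlane A
  open Biaffine A ℓ₀
  open AffineGeometry A

  Kept? : ∀ ℓ → Dec (Kept ℓ)
  Kept? ℓ = ¬? (Parallel? ℓ ℓ₀)

  kept-∥ : ∀ {ℓ m} → Kept ℓ → Parallel m ℓ → Kept m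
  kept-∥ kℓ m∥ℓ m∥ℓ₀ = kℓ (∥-trans (∥-sym m∥ℓ) m∥ℓ₀)

  kept-meets-vertical : ∀ {ℓ V} → Kept ℓ → Parallel V ℓ₀ → ∃ λ p → Inc p ℓ × Inc p V
  kept-meets-vertical kℓ V∥ℓ₀ = ∦⇒meet (λ ℓ∥V → kℓ (∥-trans ℓ∥V V∥ℓ₀))

  kept-meets-vertical-once : ∀ {ℓ V p p′} → Kept ℓ → Parallel V ℓ₀ →
                             Inc p ℓ → Inc p V → Inc p′ ℓ → Inc p′ V → p ≡ p′
  kept-meets-vertical-once kℓ V∥ℓ₀ = common-point-unique (λ { refl → kℓ V∥ℓ₀ })

  crossing⇒kept : ∀ {ℓ s o} → Inc s ℓ → Inc s ℓ₀ → Inc o ℓ → ¬ Inc o ℓ₀ → Kept ℓ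
  crossing⇒kept {o = o} s∈ℓ s∈ℓ₀ o∈ℓ o∉ℓ₀ ℓ∥ℓ₀ = o∉ℓ₀ (subst (Inc o) (∥-meet⇒≡ ℓ∥ℓ₀ s∈ℓ s∈ℓ₀) o∈ℓ)

  ∃-kept : 0 < q → ∃ Kept
  ∃-kept 0<q =
    let o , o∉ℓ₀ = point-off ℓ₀ ; s , s∈ℓ₀ = point-on 0<q ℓ₀
        d , o∈d , s∈d = join o s (∉∈⇒≢ o∉ℓ₀ s∈ℓ₀) in
    d , crossing⇒kept s∈d s∈ℓ₀ o∈d o∉ℓ₀

  vertical : Point → Line
  vertical p = proj₁ (parallelThrough p ℓ₀)

  ∈-vertical : ∀ p → Inc p (vertical p)
  ∈-vertical p = proj₁ (proj₂ (parallelThrough p ℓ₀))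

  vertical-∥ : ∀ p → Parallel (vertical p) ℓ₀
  vertical-∥ p = proj₂ (proj₂ (parallelThrough p ℓ₀))

module IncidenceGraph {q : ℕ} (A : AffinePlane q) (ℓ₀ : AffinePlane.Line A) where
  open Biaffine A ℓ₀

  Adj-sym : ∀ {u v} → Adj u v → Adj v u
  Adj-sym {inj₁ _} {inj₂ _} u~v = u~v
  Adj-sym {inj₂ _} {inj₁ _} u~v = u~v

  -- A walk u → a → w → ⋯ is replayed from v as v → b → w → ⋯, or as v → b → v → ⋯ when w = u.
  record Reroutable (u v : Vtx) : Set where
    field
      neighbour : ∀ {a} → Adj u a → ∃ λ b → Adj v b
      detour    : ∀ {a w} → Adj u a → Adj a w → w ≢ u → ∃ λ b → Adj v b × Adj b w

  Far : Vtx → Vtx → Set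
  Far u x = x ≢ u × ¬ Adj u x

  reroute : ∀ {u v x k} → Reroutable u v → Far u x → Walk u x k → Walk v x k
  reroute _ (x≢u , _) here = ⊥-elim (x≢u refl)
  reroute _ (_ , ¬u~x) (step u~x here) = ⊥-elim (¬u~x u~x)
  reroute {u} r far (step {w = a} u~a (step {w = w} a~w rest))
    with ≡-dec _≟_ _≟_ w u
  ... | yes refl = let b , v~b = Reroutable.neighbour r u~a in
                   step v~b (step (Adj-sym v~b) (reroute r far rest))
  ... | no w≢u = let b , v~b , b~w = Reroutable.detour r u~a a~w w≢u in
                 step v~b (step b~w rest)

  Dist-unique : ∀ {u x n m} → Dist u x n → Dist u x m → n ≡ m
  Dist-unique {n = n} {m} (walkₙ , shortestₙ) (walkₘ , shortestₘ) with <-cmp n m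
  ... | tri< n<m _ _ = ⊥-elim (shortestₘ n n<m walkₙ)
  ... | tri≈ _ n≡m _ = n≡m
  ... | tri> _ _ m<n = ⊥-elim (shortestₙ m m<n walkₘ)

  Dist-transport : ∀ {u v x n} → (∀ {k} → Walk u x k → Walk v x k) → (∀ {k} → Walk v x k → Walk u x k) →
                   Dist u x n → Dist v x n
  Dist-transport u⇒v v⇒u (walk , shortest) = u⇒v walk , λ m m<n walk′ → shortest m m<n (v⇒u walk′)

  twins-unresolved : ∀ {PS LS u v} → Resolving PS LS → IsVertex u → IsVertex v → u ≢ v →
                     Reroutable u v → Reroutable v u →
                     (∀ x → InS PS LS x → Far u x) → (∀ x → InS PS LS x → Far v x) → ⊥
  twins-unresolved R u-vertex v-vertex u≢v u⇒v v⇒u far-u far-v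
    with R _ _ u-vertex v-vertex u≢v
  ... | x , x∈S , n , m , dᵤ , dᵥ , n≢m =
    n≢m (Dist-unique (Dist-transport (reroute u⇒v (far-u x x∈S)) (reroute v⇒u (far-v x x∈S)) dᵤ) dᵥ)

module ResolvingSets {q : ℕ} (A : AffinePlane q) (ℓ₀ : AffinePlane.Line A) where
  open AffinePlane A
  open Biaffine A ℓ₀
  open AffineGeometry A
  open BiaffineGeometry A ℓ₀
  open IncidenceGraph A ℓ₀

  parallel-lines-reroutable : ∀ {ℓ m} → Kept m → Parallel ℓ m → Reroutable (inj₂ ℓ) (inj₂ m)
  parallel-lines-reroutable {ℓ} {m} km ℓ∥m = record { neighbour = neighbour ; detour = detour }
    where
    neighbour : ∀ {a} → Adj (inj₂ ℓ) a → ∃ λ b → Adj (inj₂ m) b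
    neighbour _ = let p , p∈m , _ = kept-meets-vertical km ∥-refl in inj₁ p , p∈m , km
    detour : ∀ {a w} → Adj (inj₂ ℓ) a → Adj a w → w ≢ inj₂ ℓ → ∃ λ b → Adj (inj₂ m) b × Adj b w
    detour {inj₁ p} {inj₂ ℓ′} (p∈ℓ , _) (p∈ℓ′ , kℓ′) ℓ′≢ℓ =
      let z , z∈ℓ′ , z∈m =
            ∦⇒meet (λ ℓ′∥m → ℓ′≢ℓ (cong inj₂ (parallel-through-unique ℓ′∥m ℓ∥m p∈ℓ′ p∈ℓ))) in
      inj₁ z , (z∈m , km) , (z∈ℓ′ , kℓ′)

  vertical-points-reroutable : ∀ {V p p′} → Parallel V ℓ₀ → Inc p V → Inc p′ V → p ≢ p′ →
                               Reroutable (inj₁ p) (inj₁ p′)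
  vertical-points-reroutable {V} {p} {p′} V∥ℓ₀ p∈V p′∈V p≢p′ =
    record { neighbour = neighbour ; detour = detour }
    where
    neighbour : ∀ {a} → Adj (inj₁ p) a → ∃ λ b → Adj (inj₁ p′) b
    neighbour {inj₂ ℓ} (_ , kℓ) =
      let m , p′∈m , m∥ℓ = parallelThrough p′ ℓ in inj₂ m , p′∈m , kept-∥ kℓ m∥ℓ
    detour : ∀ {a w} → Adj (inj₁ p) a → Adj a w → w ≢ inj₁ p → ∃ λ b → Adj (inj₁ p′) b × Adj b w
    detour {inj₂ ℓ} {inj₁ p″} (p∈ℓ , kℓ) (p″∈ℓ , _) p″≢p with p″ ≟ p′
    ... | yes refl = ⊥-elim (p≢p′ (kept-meets-vertical-once kℓ V∥ℓ₀ p∈ℓ p∈V p″∈ℓ p′∈V))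
    ... | no p″≢p′ with join p′ p″ (λ e → p″≢p′ (sym e))
    ...   | j , p′∈j , p″∈j with Parallel? j ℓ₀
    ...     | no kj = inj₂ j , (p′∈j , kj) , (p″∈j , kj)
    ...     | yes j∥ℓ₀ =
      ⊥-elim (p″≢p (cong inj₁ (sym (kept-meets-vertical-once kℓ V∥ℓ₀ p∈ℓ p∈V p″∈ℓ p″∈V))))
      where
      p″∈V : Inc p″ V
      p″∈V = subst (Inc p″) (parallel-through-unique j∥ℓ₀ V∥ℓ₀ p′∈j p′∈V) p″∈j

  module _ {PS : Subset nP} {LS : Subset nL} (R : Resolving PS LS) where

    lonely-line-far : ∀ {ℓ} → ℓ ∉ LS → ¬ (∃ λ p → p ∈ PS × Inc p ℓ) →
                      ∀ x → InS PS LS x → Far (inj₂ ℓ) x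
    lonely-line-far ℓ∉LS _ (inj₂ m) m∈LS = (λ { refl → ℓ∉LS m∈LS }) , λ ()
    lonely-line-far _ untouched (inj₁ p) p∈PS = (λ ()) , λ (p∈ℓ , _) → untouched (p , p∈PS , p∈ℓ)

    lonely-point-far : ∀ {p} → p ∉ PS → ¬ (∃ λ ℓ → ℓ ∈ LS × Inc p ℓ) →
                       ∀ x → InS PS LS x → Far (inj₁ p) x
    lonely-point-far p∉PS _ (inj₁ p′) p′∈PS = (λ { refl → p∉PS p′∈PS }) , λ ()
    lonely-point-far _ untouched (inj₂ ℓ) ℓ∈LS = (λ ()) , λ (p∈ℓ , _) → untouched (ℓ , ℓ∈LS , p∈ℓ)

    lonely-parallel-lines-equal :
      ∀ {ℓ m} → Kept ℓ → Kept m → Parallel ℓ m → ℓ ∉ LS → m ∉ LS →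
      ¬ (∃ λ p → p ∈ PS × Inc p ℓ) → ¬ (∃ λ p → p ∈ PS × Inc p m) → ℓ ≡ m
    lonely-parallel-lines-equal {ℓ} {m} kℓ km ℓ∥m ℓ∉LS m∉LS ¬tℓ ¬tm with ℓ ≟ m
    ... | yes ℓ≡m = ℓ≡m
    ... | no ℓ≢m = ⊥-elim (twins-unresolved R kℓ km (λ e → ℓ≢m (inj₂-injective e))
                      (parallel-lines-reroutable km ℓ∥m) (parallel-lines-reroutable kℓ (∥-sym ℓ∥m))
                      (lonely-line-far ℓ∉LS ¬tℓ) (lonely-line-far m∉LS ¬tm))

    lonely-vertical-points-equal :
      ∀ {V p p′} → Parallel V ℓ₀ → Inc p V → Inc p′ V → p ∉ PS → p′ ∉ PS →
      ¬ (∃ λ ℓ → ℓ ∈ LS × Inc p ℓ) → ¬ (∃ λ ℓ → ℓ ∈ LS × Inc p′ ℓ) → p ≡ p′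
    lonely-vertical-points-equal {V} {p} {p′} V∥ℓ₀ p∈V p′∈V p∉PS p′∉PS ¬tp ¬tp′ with p ≟ p′
    ... | yes p≡p′ = p≡p′
    ... | no p≢p′ = ⊥-elim (twins-unresolved R _ _ (λ e → p≢p′ (inj₁-injective e))
                      (vertical-points-reroutable V∥ℓ₀ p∈V p′∈V p≢p′)
                      (vertical-points-reroutable V∥ℓ₀ p′∈V p∈V (λ e → p≢p′ (sym e)))
                      (lonely-point-far p∉PS ¬tp) (lonely-point-far p′∉PS ¬tp′))

module BiaffineCounting {q : ℕ} (A : AffinePlane q) (ℓ₀ : AffinePlane.Line A) where
  open AffinePlane A
  open Biaffine A ℓ₀
  open AffineGeometry A
  open BiaffineGeometry A ℓ₀

  keptLines : Subset nL
  keptLines = select Kept?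

  module _ {o : Point} (o∉ℓ₀ : ¬ Inc o ℓ₀) where

    private
      spoke : ∀ {s} → Inc s ℓ₀ → ∃ λ D → Inc o D × Inc s D
      spoke s∈ℓ₀ = join o _ (∉∈⇒≢ o∉ℓ₀ s∈ℓ₀)

      spoke-kept : ∀ {s} (s∈ℓ₀ : Inc s ℓ₀) → Kept (proj₁ (spoke s∈ℓ₀))
      spoke-kept s∈ℓ₀ = let _ , o∈D , s∈D = spoke s∈ℓ₀ in crossing⇒kept s∈D s∈ℓ₀ o∈D o∉ℓ₀

      direction-spec : ∀ {ℓ} → Kept ℓ → ∃ λ s → Inc s (proj₁ (parallelThrough o ℓ)) × Inc s ℓ₀
      direction-spec {ℓ} kℓ =
        kept-meets-vertical (kept-∥ kℓ (proj₂ (proj₂ (parallelThrough o ℓ)))) ∥-refl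

    -- The point where the parallel through o meets ℓ₀ labels the parallel class of a kept line.
    direction : ∀ {ℓ} → Kept ℓ → Point
    direction kℓ = proj₁ (direction-spec kℓ)

    direction-on-ℓ₀ : ∀ {ℓ} (kℓ : Kept ℓ) → Inc (direction kℓ) ℓ₀
    direction-on-ℓ₀ kℓ = proj₂ (proj₂ (direction-spec kℓ))

    same-direction⇒∥ : ∀ {ℓ ℓ′} (kℓ : Kept ℓ) (kℓ′ : Kept ℓ′) →
                       direction kℓ ≡ direction kℓ′ → Parallel ℓ ℓ′
    same-direction⇒∥ {ℓ} {ℓ′} kℓ kℓ′ same =
      let m , o∈m , m∥ℓ = parallelThrough o ℓ ; m′ , o∈m′ , m′∥ℓ′ = parallelThrough o ℓ′
          s , s∈m , s∈ℓ₀ = direction-spec kℓ ; _ , s′∈m′ , _ = direction-spec kℓ′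
          m≡m′ = join-unique o s (∉∈⇒≢ o∉ℓ₀ s∈ℓ₀) m m′ o∈m s∈m o∈m′
                             (subst (λ x → Inc x m′) (sym same) s′∈m′) in
      ∥-trans (∥-sym m∥ℓ) (subst (λ x → Parallel x ℓ′) (sym m≡m′) m′∥ℓ′)

    -- (s, r) ↦ the parallel through r to the line os.
    ∣ℓ₀∣*∣ℓ₀∣≤∣keptLines∣ : ∣ pointsOn ℓ₀ ∣ * ∣ pointsOn ℓ₀ ∣ ≤ ∣ keptLines ∣
    ∣ℓ₀∣*∣ℓ₀∣≤∣keptLines∣ = ∣q∣*∣r∣≤∣p∣ line (λ s∈ r∈ → ∈-select⁺ Kept? (line-kept s∈ r∈)) line-injective
      where
      parallel : ∀ {s r} (s∈ : s ∈ pointsOn ℓ₀) → r ∈ pointsOn ℓ₀ →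
                 ∃ λ L → Inc r L × Parallel L (proj₁ (spoke (∈-pointsOn⁻ s∈)))
      parallel {r = r} s∈ _ = parallelThrough r (proj₁ (spoke (∈-pointsOn⁻ s∈)))

      line : ∀ {s r} → s ∈ pointsOn ℓ₀ → r ∈ pointsOn ℓ₀ → Line
      line s∈ r∈ = proj₁ (parallel s∈ r∈)

      line-kept : ∀ {s r} (s∈ : s ∈ pointsOn ℓ₀) (r∈ : r ∈ pointsOn ℓ₀) → Kept (line s∈ r∈)
      line-kept s∈ r∈ = kept-∥ (spoke-kept (∈-pointsOn⁻ s∈)) (proj₂ (proj₂ (parallel s∈ r∈)))

      line-injective : ∀ {s r s′ r′} (s∈ : s ∈ pointsOn ℓ₀) (r∈ : r ∈ pointsOn ℓ₀)
                       (s′∈ : s′ ∈ pointsOn ℓ₀) (r′∈ : r′ ∈ pointsOn ℓ₀) →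
                       line s∈ r∈ ≡ line s′∈ r′∈ → s ≡ s′ × r ≡ r′
      line-injective {s} {r} {s′} {r′} s∈ r∈ s′∈ r′∈ same =
        let L , r∈L , L∥D = parallel s∈ r∈ ; L′ , r′∈L′ , L′∥D′ = parallel s′∈ r′∈
            D , o∈D , s∈D = spoke (∈-pointsOn⁻ s∈) ; D′ , o∈D′ , s′∈D′ = spoke (∈-pointsOn⁻ s′∈)
            D∥D′ = ∥-trans (∥-sym L∥D) (subst (λ x → Parallel x D′) (sym same) L′∥D′)
            D≡D′ = parallel-through-unique D∥D′ ∥-refl o∈D o∈D′ in
        kept-meets-vertical-once (spoke-kept (∈-pointsOn⁻ s∈)) ∥-refl s∈D (∈-pointsOn⁻ s∈)
                                 (subst (Inc s′) (sym D≡D′) s′∈D′) (∈-pointsOn⁻ s′∈) ,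
        kept-meets-vertical-once (line-kept s∈ r∈) ∥-refl r∈L (∈-pointsOn⁻ r∈)
                                 (subst (Inc r′) (sym same) r′∈L′) (∈-pointsOn⁻ r′∈)

  module _ {d : Line} (kd : Kept d) where

    private
      foot-spec : ∀ p → ∃ λ t → Inc t d × Inc t (vertical p)
      foot-spec p = kept-meets-vertical kd (vertical-∥ p)

    -- The point where the vertical through p meets d labels the vertical of p.
    foot : Point → Point
    foot p = proj₁ (foot-spec p)

    foot-on-d : ∀ p → Inc (foot p) d
    foot-on-d p = proj₁ (proj₂ (foot-spec p))

    same-foot⇒∈-vertical : ∀ {p p′} → foot p ≡ foot p′ → Inc p′ (vertical p)
    same-foot⇒∈-vertical {p} {p′} same =
      subst (Inc p′) (parallel-through-unique (vertical-∥ p′) (vertical-∥ p)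
                        (subst (λ x → Inc x (vertical p′)) (sym same) (proj₂ (proj₂ (foot-spec p′))))
                        (proj₂ (proj₂ (foot-spec p))))
            (∈-vertical p′)

    -- (r, t) ↦ the meet of the parallel through r to d with the vertical through t.
    ∣ℓ₀∣*∣d∣≤∣⊤∣ : ∣ pointsOn ℓ₀ ∣ * ∣ pointsOn d ∣ ≤ ∣ ⊤ {nP} ∣
    ∣ℓ₀∣*∣d∣≤∣⊤∣ = ∣q∣*∣r∣≤∣p∣ point (λ _ _ → ∈⊤) point-injective
      where
      parallel-kept : ∀ r → Kept (proj₁ (parallelThrough r d))
      parallel-kept r = kept-∥ kd (proj₂ (proj₂ (parallelThrough r d)))

      meet : ∀ r t → ∃ λ z → Inc z (proj₁ (parallelThrough r d)) × Inc z (vertical t)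
      meet r t = kept-meets-vertical (parallel-kept r) (vertical-∥ t)

      point : ∀ {r t} → r ∈ pointsOn ℓ₀ → t ∈ pointsOn d → Point
      point {r} {t} _ _ = proj₁ (meet r t)

      point-injective : ∀ {r t r′ t′} (r∈ : r ∈ pointsOn ℓ₀) (t∈ : t ∈ pointsOn d)
                        (r′∈ : r′ ∈ pointsOn ℓ₀) (t′∈ : t′ ∈ pointsOn d) →
                        point r∈ t∈ ≡ point r′∈ t′∈ → r ≡ r′ × t ≡ t′
      point-injective {r} {t} {r′} {t′} r∈ t∈ r′∈ t′∈ same =
        let P , r∈P , P∥d = parallelThrough r d ; P′ , r′∈P′ , P′∥d = parallelThrough r′ d
            z , z∈P , z∈Vt = meet r t ; _ , z∈P′ , z∈Vt′ = meet r′ t′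
            P≡P′ = parallel-through-unique P∥d P′∥d z∈P (subst (λ x → Inc x P′) (sym same) z∈P′)
            Vt≡Vt′ = parallel-through-unique (vertical-∥ t) (vertical-∥ t′) z∈Vt
                       (subst (λ x → Inc x (vertical t′)) (sym same) z∈Vt′) in
        kept-meets-vertical-once (parallel-kept r) ∥-refl r∈P (∈-pointsOn⁻ r∈)
                                 (subst (Inc r′) (sym P≡P′) r′∈P′) (∈-pointsOn⁻ r′∈) ,
        kept-meets-vertical-once kd (vertical-∥ t) (∈-pointsOn⁻ t∈) (∈-vertical t)
                                 (∈-pointsOn⁻ t′∈) (subst (Inc t′) (sym Vt≡Vt′) (∈-vertical t′))

module ResolvingBounds {q : ℕ} (A : AffinePlane q) (ℓ₀ : AffinePlane.Line A)
                       {PS : Subset (AffinePlane.nP A)} {LS : Subset (AffinePlane.nL A)}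
                       (R : Biaffine.Resolving A ℓ₀ PS LS) where
  open AffinePlane A
  open Biaffine A ℓ₀
  open AffineGeometry A
  open BiaffineGeometry A ℓ₀
  open ResolvingSets A ℓ₀
  open BiaffineCounting A ℓ₀

  lines-bound : ∀ {o} → ¬ Inc o ℓ₀ → q * q ≤ ∣ LS ∣ + (∣ PS ∣ * q + q)
  lines-bound o∉ℓ₀ = subst (λ c → c * c ≤ ∣ LS ∣ + (∣ PS ∣ * c + c)) (order ℓ₀) (≤-trans
    (∣ℓ₀∣*∣ℓ₀∣≤∣keptLines∣ o∉ℓ₀)
    (∣X∣≤∣S∣+∣T∣*∣C∣+∣C∣ {X = keptLines} {S = LS} {T = PS} {C = pointsOn ℓ₀} (λ ℓ p → Inc? p ℓ)
      (λ ℓ∈ → direction o∉ℓ₀ (kept ℓ∈)) (λ ℓ∈ → ∈-pointsOn⁺ (direction-on-ℓ₀ o∉ℓ₀ (kept ℓ∈)))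
      (λ ℓ∈ ℓ′∈ same _ → ∥-meet⇒≡ (same-direction⇒∥ o∉ℓ₀ (kept ℓ∈) (kept ℓ′∈) same))
      (λ ℓ∈ ℓ′∈ → lonely-parallel-lines-equal R (kept ℓ∈) (kept ℓ′∈)
                    ∘ same-direction⇒∥ o∉ℓ₀ (kept ℓ∈) (kept ℓ′∈))))
    where
    kept : ∀ {ℓ} → ℓ ∈ keptLines → Kept ℓ
    kept = ∈-select⁻ Kept?

  points-bound : (∀ ℓ → ℓ ∈ LS → Kept ℓ) → ∀ {d} → Kept d → q * q ≤ ∣ PS ∣ + (∣ LS ∣ * q + q)
  points-bound LS-kept {d} kd =
    subst₂ (λ a c → a * c ≤ ∣ PS ∣ + (∣ LS ∣ * c + c)) (order ℓ₀) (order d) (≤-trans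
      (∣ℓ₀∣*∣d∣≤∣⊤∣ kd)
      (∣X∣≤∣S∣+∣T∣*∣C∣+∣C∣ {X = ⊤} {S = PS} {T = LS} {C = pointsOn d} Inc?
        (λ {p} _ → foot kd p) (λ {p} _ → ∈-pointsOn⁺ (foot-on-d kd p))
        (λ {p} _ _ same ℓ∈LS p∈ℓ p′∈ℓ → kept-meets-vertical-once (LS-kept _ ℓ∈LS) (vertical-∥ p)
                                         p∈ℓ (∈-vertical p) p′∈ℓ (same-foot⇒∈-vertical kd same))
        (λ {p} _ _ same → lonely-vertical-points-equal R (vertical-∥ p) (∈-vertical p)
                                                       (same-foot⇒∈-vertical kd same))))

q*q≤s+[t*q+q]⇒q*[q∸1]≤[q∸1]*t+[t+s] :
  ∀ q s t → q * q ≤ s + (t * q + q) → q * (q ∸ 1) ≤ (q ∸ 1) * t + (t + s)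
q*q≤s+[t*q+q]⇒q*[q∸1]≤[q∸1]*t+[t+s] zero s t _ = z≤n
q*q≤s+[t*q+q]⇒q*[q∸1]≤[q∸1]*t+[t+s] (suc k) s t bound =
  +-cancelʳ-≤ (suc k) _ _ (subst₂ _≤_ (square k) (rearranged k s t) bound)
  where
  square : ∀ k → suc k * suc k ≡ suc k * k + suc k
  square = solve-∀
  rearranged : ∀ k s t → s + (t * suc k + suc k) ≡ k * t + (t + s) + suc k
  rearranged = solve-∀

mainTheorem13 : (q : ℕ) (A : AffinePlane q) (ℓ₀ : AffinePlane.Line A)
                (PS : Subset (AffinePlane.nP A)) (LS : Subset (AffinePlane.nL A)) →
                (∀ ℓ → ℓ ∈ LS → Biaffine.Kept A ℓ₀ ℓ) →
                Biaffine.Resolving A ℓ₀ PS LS →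
                (q * (q ∸ 1) ≤ (q ∸ 1) * ∣ PS ∣ + (∣ PS ∣ + ∣ LS ∣))
                × (q * (q ∸ 1) ≤ (q ∸ 1) * ∣ LS ∣ + (∣ PS ∣ + ∣ LS ∣))
mainTheorem13 zero _ _ _ _ _ _ = z≤n , z≤n
mainTheorem13 q@(suc _) A ℓ₀ PS LS LS-kept R =
  q*q≤s+[t*q+q]⇒q*[q∸1]≤[q∸1]*t+[t+s] q _ _ (lines-bound (proj₂ (point-off ℓ₀))) ,
  subst (λ n → q * (q ∸ 1) ≤ (q ∸ 1) * ∣ LS ∣ + n) (+-comm ∣ LS ∣ ∣ PS ∣)
    (q*q≤s+[t*q+q]⇒q*[q∸1]≤[q∸1]*t+[t+s] q _ _ (points-bound LS-kept (proj₂ (∃-kept (s≤s z≤n)))))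
  where
  open AffineGeometry A
  open BiaffineGeometry A ℓ₀
  open ResolvingBounds A ℓ₀ R
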